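{- Let $\mathcal{D}$ be the distribution over metrics $\mathsf{d}$ on $[n]$ obtained as follows: set $\mathsf{d}(i,j)=1+\frac{|i-j|}{n-1}$ for all distinct $i,j$ (and $\mathsf{d}(i,i)=0$), then choose an unordered pair $\{i^\ast,j^\ast\}$ uniformly at random from all $\binom{n}{2}$ pairs and overwrite $\mathsf{d}(i^\ast,j^\ast)=\mathsf{d}(j^\ast,i^\ast)=1$. Let $\mathcal{A}$ be any deterministic algorithm that makes $o(n^2)$ queries to $\mathsf{d}$ and outputs a directed graph $G$ on $[n]$ with $o(n^2)$ edges. Then, with probability $1-o(1)$ over $\mathsf{d}\sim\mathcal{D}$, the output graph $G$ is not navigable on $\mathsf{d}$.
   Context: A directed graph $G=([n],E)$ is navigable on a metric $\mathsf{d}$ if for every $s,t$ with $\mathsf{d}(s,t)>0$ there is $u$ with $(s,u)\in E$ and $\mathsf{d}(u,t)<\mathsf{d}(s,t)$. A query returns $\mathsf{d}(i,j)$ for a chosen pair; asymptotics are as $n\to\infty$. -}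

module Defs where

open import Data.Bool using (Bool; true; false; T; if_then_else_)
open import Data.Nat as ℕ using (ℕ; zero; suc; ∣_-_∣)
open import Data.Fin as Fin using (Fin; toℕ; _≟_)
open import Data.Fin.Properties using (all?; any?)
open import Data.Integer using (+_)
open import Data.Rational using (ℚ; 0ℚ; 1ℚ; _+_; _/_; _<_)
open import Data.Rational.Properties using (_<?_)
open import Data.Product using (Σ; ∃; _×_; _,_)
open import Data.List using (List; length; filter; cartesianProduct)
open import Data.List.Base using () renaming (allFin to allFinL)
open import Relation.Nullary using (Dec; yes; no)
open import Relation.Nullary.Decidable using (_→-dec_; _×-dec_; does)
open import Data.Bool.Properties using (T?)

Dist : ℕ → Set
Dist n = Fin n → Fin n → ℚ

Graph : ℕ → Set
Graph n = Fin n → Fin n → Bool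

Navigable : ∀ {n} → Graph n → Dist n → Set
Navigable {n} G d = ∀ (s t : Fin n) → 0ℚ < d s t →
  ∃ λ (u : Fin n) → T (G s u) × (d u t < d s t)

navigable? : ∀ {n} (G : Graph n) (d : Dist n) → Dec (Navigable G d)
navigable? G d = all? λ s → all? λ t →
  (0ℚ <? d s t) →-dec any? (λ u → T? (G s u) ×-dec (d u t <? d s t))

allPairs : (n : ℕ) → List (Fin n × Fin n)
allPairs n = cartesianProduct (allFinL n) (allFinL n)

edgeCount : ∀ {n} → Graph n → ℕ
edgeCount {n} G = length (filter (λ { (s , t) → T? (G s t) }) (allPairs n))

-- The C(n,2) unordered pairs {i*, j*}, each listed once as (i*, j*) with i* < j*.
unorderedPairs : (n : ℕ) → List (Fin n × Fin n)
unorderedPairs n = filter (λ { (i , j) → toℕ i ℕ.<? toℕ j }) (allPairs n)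

-- a / m as a rational (m = 0 never used in the relevant case n ≥ 2).
frac : ℕ → ℕ → ℚ
frac a zero = 0ℚ
frac a (suc m) = (+ a) / suc m

baseDist : (n : ℕ) → Dist n
baseDist n i j with does (i ≟ j)
... | true  = 0ℚ
... | false = 1ℚ + frac ∣ toℕ i - toℕ j ∣ (n ℕ.∸ 1)

-- The metric drawn from 𝒟 when the chosen pair is {a, b}:
-- base metric with d(a,b) = d(b,a) = 1 overwritten.
pairDist : (n : ℕ) → Fin n → Fin n → Dist n
pairDist n a b i j =
  if (does (i ≟ a) Data.Bool.∧ does (j ≟ b)) Data.Bool.∨ (does (i ≟ b) Data.Bool.∧ does (j ≟ a))
  then 1ℚ else baseDist n i j

-- A deterministic (adaptive) query algorithm on [n]: a decision tree that
-- either outputs a graph, or queries d(i,j) and continues depending on the answer.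
data QueryAlg (n : ℕ) : Set where
  output : Graph n → QueryAlg n
  query  : Fin n → Fin n → (ℚ → QueryAlg n) → QueryAlg n

runGraph : ∀ {n} → QueryAlg n → Dist n → Graph n
runGraph (output G) d = G
runGraph (query i j k) d = runGraph (k (d i j)) d

runQueries : ∀ {n} → QueryAlg n → Dist n → ℕ
runQueries (output G) d = 0
runQueries (query i j k) d = suc (runQueries (k (d i j)) d)

navigableCount : (n : ℕ) → QueryAlg n → ℕ
navigableCount n A = length (filter (λ { (a , b) →
  navigable? (runGraph A (pairDist n a b)) (pairDist n a b) }) (unorderedPairs n))

-- f(n, ·) = o(n²) uniformly over the support of 𝒟:
-- for every k there is N such that for n ≥ N and every pair a<b, k·f ≤ n².
LittleOSq : ((n : ℕ) → Fin n → Fin n → ℕ) → Set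
LittleOSq f = ∀ (k : ℕ) → ∃ λ (N : ℕ) → ∀ (n : ℕ) → N ℕ.≤ n →
  ∀ (a b : Fin n) → toℕ a ℕ.< toℕ b → k ℕ.* f n a b ℕ.≤ n ℕ.* n

-- Run the algorithm on the base metric and let H be the set of pairs it asks
-- about in its first M steps, closed under swapping; |H| ≤ 2M.  If the planted
-- pair {a, b} avoids H, the algorithm cannot tell pairDist a b from the base
-- metric within M queries, so it outputs the same graph G₀.  On pairDist a b
-- every point other than b is at distance ≥ 1 = d(a, b) from b, so navigability
-- forces the edge a → b of G₀.  Hence at most 2M + |E(G₀)| = o(n²) of the C(n,2) planted pairs
-- yield a navigable output.
module Submission where

open import Defs
open import Data.Nat using (ℕ; _*_; _≤_)
open import Data.Nat.Combinatorics using (_C_)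
open import Data.Product using (∃)

open import Data.Bool using (true; false; T; _∧_; _∨_)
open import Data.Bool.Properties using (T?)
open import Data.Empty using (⊥-elim)
open import Data.Fin using (Fin; toℕ; _≟_)
open import Data.List using (List; []; _∷_; length; filter; map; _++_)
open import Data.List.Properties using (length-++; length-map; filter-notAll)
open import Data.List.Membership.Propositional using (_∈_; _∉_)
open import Data.List.Membership.Propositional.Properties
  using (∈-filter⁺; ∈-filter⁻; ∈-cartesianProduct⁺; ∈-allFin; ∈-++⁺ˡ; ∈-++⁺ʳ; ∈-map⁺)
import Data.List.Membership.DecPropositional as DecMembership
import Data.List.Relation.Unary.All as All
open import Data.List.Relation.Unary.Any as Any using (here; there)
open import Data.List.Relation.Binary.Subset.Propositional using (_⊆_)
open import Data.List.Relation.Unary.Unique.Propositional using (Unique; []; _∷_)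
open import Data.List.Relation.Unary.Unique.Propositional.Properties
  using (allFin⁺; cartesianProduct⁺; filter⁺)
open import Data.Nat as ℕ using (suc; _+_; _<_; _⊔_; NonZero; z≤n; s≤s)
open import Data.Nat.Combinatorics using (nC1≡n; nCk+nC[k+1]≡[n+1]C[k+1])
open import Data.Nat.DivMod using (_/_; m*n/n≡m; /-monoˡ-≤; m/n*n≤m)
import Data.Nat.Properties as ℕₚ
open import Data.Nat.Tactic.RingSolver using (solve-∀)
open import Data.Product using (_×_; _,_; proj₁; proj₂; swap)
open import Data.Product.Properties using (≡-dec)
open import Data.Rational as ℚ using (0ℚ; 1ℚ)
import Data.Rational.Properties as ℚₚ
open import Data.Sum using (_⊎_; inj₁; inj₂)
open import Function using (_∘_)
open import Relation.Binary.Definitions using (DecidableEquality)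
open import Relation.Binary.PropositionalEquality
open import Relation.Nullary using (Dec; yes; no; ¬?)
open import Relation.Nullary.Decidable using (does; dec-true)

Unique∧⊆⇒length-≤ : ∀ {a} {A : Set a} → DecidableEquality A →
  {xs ys : List A} → Unique xs → xs ⊆ ys → length xs ≤ length ys
Unique∧⊆⇒length-≤ _≟ₐ_ {[]}     _             _     = z≤n
Unique∧⊆⇒length-≤ _≟ₐ_ {x ∷ xs} {ys} (x∉xs ∷ xs!) xs⊆ys = begin
  suc (length xs)    ≤⟨ s≤s (Unique∧⊆⇒length-≤ _≟ₐ_ xs! xs⊆ys-x) ⟩
  suc (length ys-x)  ≤⟨ filter-notAll ≢x? ys (Any.map (λ x≡y y≢x → y≢x (sym x≡y)) (xs⊆ys (here refl))) ⟩
  length ys          ∎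
  where
  open ℕₚ.≤-Reasoning
  ≢x? = ¬? ∘ (_≟ₐ x)
  ys-x = filter ≢x? ys
  xs⊆ys-x : xs ⊆ ys-x
  xs⊆ys-x y∈xs = ∈-filter⁺ ≢x? (xs⊆ys (there y∈xs)) (λ y≡x → All.lookup x∉xs y∈xs (sym y≡x))

0≤frac : ∀ a m → 0ℚ ℚ.≤ frac a m
0≤frac a 0       = ℚₚ.≤-refl
0≤frac a (suc m) = ℚₚ.nonNegative⁻¹ _ {{ℚₚ.normalize-nonNeg a (suc m)}}

module _ {n : ℕ} where

  Pair : Set
  Pair = Fin n × Fin n

  _≟ₚ_ : DecidableEquality Pair
  _≟ₚ_ = ≡-dec _≟_ _≟_

  queryTrace : QueryAlg n → Dist n → ℕ → List Pair
  queryTrace (output G)    d m       = []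
  queryTrace (query i j k) d 0       = []
  queryTrace (query i j k) d (suc m) = (i , j) ∷ queryTrace (k (d i j)) d m

  length-queryTrace : ∀ T d m → length (queryTrace T d m) ≤ m
  length-queryTrace (output G)    d m       = z≤n
  length-queryTrace (query i j k) d 0       = z≤n
  length-queryTrace (query i j k) d (suc m) = s≤s (length-queryTrace (k (d i j)) d m)

  runGraph-agree : ∀ T {d e : Dist n} m → runQueries T d ≤ m →
    (∀ {i j} → (i , j) ∈ queryTrace T e m → d i j ≡ e i j) →
    runGraph T d ≡ runGraph T e
  runGraph-agree (output G)            m       _ _   = refl
  runGraph-agree (query i j k) {d} {e} (suc m) q d≡e with d i j | d≡e (here refl)
  ... | _ | refl = runGraph-agree (k (e i j)) m (ℕₚ.≤-pred q) (d≡e ∘ there)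

  edges : Graph n → List Pair
  edges G = filter (λ { (s , t) → T? (G s t) }) (allPairs n)

  ∈-edges : {G : Graph n} {s t : Fin n} → T (G s t) → (s , t) ∈ edges G
  ∈-edges = ∈-filter⁺ _ (∈-cartesianProduct⁺ (∈-allFin _) (∈-allFin _))

  navigable⇒edge : {G : Graph n} {d : Dist n} {s t : Fin n} → Navigable G d →
    0ℚ ℚ.< d s t → (∀ u → u ≢ t → d s t ℚ.≤ d u t) → T (G s t)
  navigable⇒edge {t = t} nav 0<dst nearest with nav _ t 0<dst
  ... | u , Gsu , dut<dst with u ≟ t
  ...   | yes refl = Gsu
  ...   | no u≢t   = ⊥-elim (ℚₚ.<-irrefl refl (ℚₚ.<-≤-trans dut<dst (nearest u u≢t)))

  1≤baseDist : {i j : Fin n} → i ≢ j → 1ℚ ℚ.≤ baseDist n i j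
  1≤baseDist {i} {j} i≢j with i ≟ j
  ... | yes i≡j = ⊥-elim (i≢j i≡j)
  ... | no _    = subst (ℚ._≤ 1ℚ ℚ.+ frac gap (n ℕ.∸ 1)) (ℚₚ.+-identityʳ 1ℚ)
                          (ℚₚ.+-monoʳ-≤ 1ℚ (0≤frac gap (n ℕ.∸ 1)))
    where gap = ℕ.∣ toℕ i - toℕ j ∣

  1≤pairDist : ∀ (a b : Fin n) {i j} → i ≢ j → 1ℚ ℚ.≤ pairDist n a b i j
  1≤pairDist a b {i} {j} i≢j
    with (does (i ≟ a) ∧ does (j ≟ b)) ∨ (does (i ≟ b) ∧ does (j ≟ a))
  ... | true  = ℚₚ.≤-refl
  ... | false = 1≤baseDist i≢j

  pairDist-planted : ∀ (a b : Fin n) → pairDist n a b a b ≡ 1ℚ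
  pairDist-planted a b rewrite dec-true (a ≟ a) refl | dec-true (b ≟ b) refl = refl

  pairDist-unplanted : ∀ (a b : Fin n) {i j} → (i , j) ≢ (a , b) → (j , i) ≢ (a , b) →
    pairDist n a b i j ≡ baseDist n i j
  pairDist-unplanted a b {i} {j} ij≢ab ji≢ab with i ≟ a | j ≟ b | i ≟ b | j ≟ a
  ... | yes refl | yes refl | _        | _        = ⊥-elim (ij≢ab refl)
  ... | _        | _        | yes refl | yes refl = ⊥-elim (ji≢ab refl)
  ... | no _     | _        | no _     | _        = refl
  ... | no _     | _        | yes _    | no _     = refl
  ... | yes _    | no _     | no _     | _        = refl
  ... | yes _    | no _     | yes _    | no _     = refl

  navigable-pairDist⇒edge : ∀ {G : Graph n} (a b : Fin n) →
    Navigable G (pairDist n a b) → T (G a b)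
  navigable-pairDist⇒edge a b nav = navigable⇒edge nav
    (subst (0ℚ ℚ.<_) (sym (pairDist-planted a b)) (ℚₚ.positive⁻¹ 1ℚ))
    (λ u u≢b → subst (ℚ._≤ pairDist n a b u b) (sym (pairDist-planted a b)) (1≤pairDist a b u≢b))

  navigablePairs : QueryAlg n → List Pair
  navigablePairs A = filter (λ { (a , b) →
    navigable? (runGraph A (pairDist n a b)) (pairDist n a b) }) (unorderedPairs n)

  navigablePairs-unique : ∀ A → Unique (navigablePairs A)
  navigablePairs-unique A =
    filter⁺ _ (filter⁺ _ (cartesianProduct⁺ (allFin⁺ n) (allFin⁺ n)))

  ∈-navigablePairs⁻ : ∀ A {a b} → (a , b) ∈ navigablePairs A →
    toℕ a < toℕ b × Navigable (runGraph A (pairDist n a b)) (pairDist n a b)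
  ∈-navigablePairs⁻ A ab∈ with ∈-filter⁻ _ {xs = unorderedPairs n} ab∈
  ... | ab∈unordered , nav = proj₂ (∈-filter⁻ _ {xs = allPairs n} ab∈unordered) , nav

  symmetricTrace : QueryAlg n → ℕ → List Pair
  symmetricTrace A M = trace ++ map swap trace
    where trace = queryTrace A (baseDist n) M

  length-symmetricTrace : ∀ A M → length (symmetricTrace A M) ≤ M + M
  length-symmetricTrace A M = begin
    length (trace ++ map swap trace)         ≡⟨ length-++ trace ⟩
    length trace + length (map swap trace)   ≡⟨ cong (length trace +_) (length-map swap trace) ⟩
    length trace + length trace              ≤⟨ ℕₚ.+-mono-≤ trace≤M trace≤M ⟩
    M + M                                    ∎
    where
    open ℕₚ.≤-Reasoning
    trace = queryTrace A (baseDist n) M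
    trace≤M = length-queryTrace A (baseDist n) M

  runGraph-unplanted : ∀ A M {a b} → runQueries A (pairDist n a b) ≤ M →
    (a , b) ∉ symmetricTrace A M → runGraph A (pairDist n a b) ≡ runGraph A (baseDist n)
  runGraph-unplanted A M {a} {b} queries≤M ab∉ = runGraph-agree A M queries≤M λ ij∈ →
    pairDist-unplanted a b
      (λ ij≡ab → ab∉ (∈-++⁺ˡ (subst (_∈ _) ij≡ab ij∈)))
      (λ ji≡ab → ab∉ (∈-++⁺ʳ _ (subst (_∈ _) ji≡ab (∈-map⁺ swap ij∈))))

  navigable⇒traced⊎baseEdge : ∀ A M {a b} → runQueries A (pairDist n a b) ≤ M →
    Navigable (runGraph A (pairDist n a b)) (pairDist n a b) →
    (a , b) ∈ symmetricTrace A M ⊎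
      (runGraph A (pairDist n a b) ≡ runGraph A (baseDist n) × T (runGraph A (baseDist n) a b))
  navigable⇒traced⊎baseEdge A M {a} {b} queries≤M nav
    with DecMembership._∈?_ _≟ₚ_ (a , b) (symmetricTrace A M)
  ... | yes ab∈ = inj₁ ab∈
  ... | no ab∉  = inj₂ (G≡G₀ , subst (λ G → T (G a b)) G≡G₀ (navigable-pairDist⇒edge a b nav))
    where G≡G₀ = runGraph-unplanted A M queries≤M ab∉

  navigableCount-≤ : ∀ A M E →
    (∀ a b → toℕ a < toℕ b → runQueries A (pairDist n a b) ≤ M) →
    (∀ a b → toℕ a < toℕ b → edgeCount (runGraph A (pairDist n a b)) ≤ E) →
    navigableCount n A ≤ M + M + E
  navigableCount-≤ A M E queries≤M edges≤E = bound (edgeCount G₀ ℕ.≤? E)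
    where
    open ℕₚ.≤-Reasoning
    G₀ = runGraph A (baseDist n)
    H  = symmetricTrace A M

    split : ∀ {a b} → (a , b) ∈ navigablePairs A →
      (a , b) ∈ H ⊎ (runGraph A (pairDist n a b) ≡ G₀ × T (G₀ a b))
    split ab∈ with ∈-navigablePairs⁻ A ab∈
    ... | a<b , nav = navigable⇒traced⊎baseEdge A M (queries≤M _ _ a<b) nav

    -- G₀ is the output on the base metric, which lies outside the support of
    -- the distribution, so |E(G₀)| ≤ E only follows once a navigable pair escapes H.
    bound : Dec (edgeCount G₀ ≤ E) → length (navigablePairs A) ≤ M + M + E
    bound (yes G₀≤E) = begin
      length (navigablePairs A)  ≤⟨ Unique∧⊆⇒length-≤ _≟ₚ_ (navigablePairs-unique A) ⊆H++E₀ ⟩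
      length (H ++ edges G₀)     ≡⟨ length-++ H ⟩
      length H + edgeCount G₀    ≤⟨ ℕₚ.+-mono-≤ (length-symmetricTrace A M) G₀≤E ⟩
      M + M + E                  ∎
      where
      ⊆H++E₀ : navigablePairs A ⊆ H ++ edges G₀
      ⊆H++E₀ ab∈ with split ab∈
      ... | inj₁ ab∈H       = ∈-++⁺ˡ ab∈H
      ... | inj₂ (_ , G₀ab) = ∈-++⁺ʳ H (∈-edges G₀ab)
    bound (no G₀≰E) = begin
      length (navigablePairs A)  ≤⟨ Unique∧⊆⇒length-≤ _≟ₚ_ (navigablePairs-unique A) ⊆H ⟩
      length H                   ≤⟨ length-symmetricTrace A M ⟩
      M + M                      ≤⟨ ℕₚ.m≤m+n (M + M) E ⟩
      M + M + E                  ∎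
      where
      ⊆H : navigablePairs A ⊆ H
      ⊆H ab∈ with split ab∈
      ... | inj₁ ab∈H        = ab∈H
      ... | inj₂ (G≡G₀ , _) = ⊥-elim (G₀≰E (subst (λ G → edgeCount G ≤ E) G≡G₀
                                (edges≤E _ _ (proj₁ (∈-navigablePairs⁻ A ab∈)))))

n*n≤4*nC2 : ∀ n → 2 ≤ n → n * n ≤ 4 * (n C 2)
n*n≤4*nC2 (suc (suc m)) (s≤s (s≤s z≤n)) = go m
  where
  open ℕₚ.≤-Reasoning
  square-step : ∀ m → (3 + m) * (3 + m) + (3 + 2 * m) ≡ (2 + m) * (2 + m) + 4 * (2 + m)
  square-step = solve-∀
  go : ∀ m → (2 + m) * (2 + m) ≤ 4 * ((2 + m) C 2)
  go 0       = ℕₚ.≤-refl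
  go (suc m) = begin
    (3 + m) * (3 + m)                    ≤⟨ ℕₚ.m≤m+n _ (3 + 2 * m) ⟩
    (3 + m) * (3 + m) + (3 + 2 * m)      ≡⟨ square-step m ⟩
    (2 + m) * (2 + m) + 4 * (2 + m)      ≤⟨ ℕₚ.+-monoˡ-≤ (4 * (2 + m)) (go m) ⟩
    4 * ((2 + m) C 2) + 4 * (2 + m)      ≡⟨ sym (ℕₚ.*-distribˡ-+ 4 ((2 + m) C 2) (2 + m)) ⟩
    4 * ((2 + m) C 2 + (2 + m))          ≡⟨ cong (λ x → 4 * ((2 + m) C 2 + x)) (sym (nC1≡n (2 + m))) ⟩
    4 * ((2 + m) C 2 + (2 + m) C 1)      ≡⟨ cong (4 *_) (ℕₚ.+-comm ((2 + m) C 2) ((2 + m) C 1)) ⟩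
    4 * ((2 + m) C 1 + (2 + m) C 2)      ≡⟨ cong (4 *_) (nCk+nC[k+1]≡[n+1]C[k+1] (2 + m) 1) ⟩
    4 * ((3 + m) C 2)                    ∎

*≤⇒≤/ : ∀ K {x y} .{{_ : NonZero K}} → K * x ≤ y → x ≤ y / K
*≤⇒≤/ K {x} {y} Kx≤y = subst (_≤ y / K) (m*n/n≡m x K)
  (/-monoˡ-≤ K (subst (_≤ y) (ℕₚ.*-comm K x) Kx≤y))

k*c≤nC2 : ∀ k n c → 2 ≤ n → let q = n * n / (12 * suc k) in c ≤ q + q + q → k * c ≤ n C 2
k*c≤nC2 k n c 2≤n c≤3q = ℕₚ.*-cancelˡ-≤ 12 (begin
  12 * (k * c)          ≤⟨ ℕₚ.*-monoʳ-≤ 12 (ℕₚ.*-monoˡ-≤ c (ℕₚ.n≤1+n k)) ⟩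
  12 * (suc k * c)      ≡⟨ sym (ℕₚ.*-assoc 12 (suc k) c) ⟩
  K * c                 ≤⟨ ℕₚ.*-monoʳ-≤ K c≤3q ⟩
  K * (q + q + q)       ≡⟨ triple K q ⟩
  3 * (q * K)           ≤⟨ ℕₚ.*-monoʳ-≤ 3 (m/n*n≤m (n * n) K) ⟩
  3 * (n * n)           ≤⟨ ℕₚ.*-monoʳ-≤ 3 (n*n≤4*nC2 n 2≤n) ⟩
  3 * (4 * (n C 2))     ≡⟨ sym (ℕₚ.*-assoc 3 4 (n C 2)) ⟩
  12 * (n C 2)          ∎)
  where
  open ℕₚ.≤-Reasoning
  K = 12 * suc k
  q = n * n / K
  triple : ∀ K q → K * (q + q + q) ≡ 3 * (q * K)
  triple = solve-∀

lemma6p4 : (A : (n : ℕ) → QueryAlg n) →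
    LittleOSq (λ n a b → runQueries (A n) (pairDist n a b)) →
    LittleOSq (λ n a b → edgeCount (runGraph (A n) (pairDist n a b))) →
    ∀ (k : ℕ) → ∃ λ (N : ℕ) → ∀ (n : ℕ) → N ≤ n →
      k * navigableCount n (A n) ≤ n C 2
lemma6p4 A queries-o edges-o k = Nq ⊔ Ne ⊔ 2 , bound
  where
  K = 12 * suc k
  Nq = proj₁ (queries-o K)
  Ne = proj₁ (edges-o K)
  bound : ∀ n → Nq ⊔ Ne ⊔ 2 ≤ n → k * navigableCount n (A n) ≤ n C 2
  bound n N≤n = k*c≤nC2 k n _ (ℕₚ.m⊔n≤o⇒n≤o _ 2 N≤n) (navigableCount-≤ (A n) q q
    (λ a b a<b → *≤⇒≤/ K (proj₂ (queries-o K) n Nq≤n a b a<b))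
    (λ a b a<b → *≤⇒≤/ K (proj₂ (edges-o K) n Ne≤n a b a<b)))
    where
    q = n * n / K
    Nq⊔Ne≤n = ℕₚ.m⊔n≤o⇒m≤o (Nq ⊔ Ne) 2 N≤n
    Nq≤n = ℕₚ.m⊔n≤o⇒m≤o Nq Ne Nq⊔Ne≤n
    Ne≤n = ℕₚ.m⊔n≤o⇒n≤o Nq Ne Nq⊔Ne≤n
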